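{- Let $L_n$ be the para-chain hexagonal cactus with $n$ hexagons. Then for every $n\ge 1$ and $k\ge 1$: (i) $Mo(L_n)=60k^2$ if $n=2k$, and $Mo(L_n)=60k^2+60k$ if $n=2k+1$; (ii) $Mo_e(L_n)=72k^2$ if $n=2k$, and $Mo_e(L_n)=72k^2+72k$ if $n=2k+1$.
   Context: The para-chain hexagonal graph $L_n$ consists of $n$ 6-cycles (hexagons) $H_1,\ldots,H_n$ such that $H_i$ and $H_{i+1}$ share exactly one vertex for $i=1,\ldots,n-1$, non-consecutive hexagons are vertex-disjoint, and for $2\le i\le n-1$ the vertex $H_i$ shares with $H_{i-1}$ and the vertex it shares with $H_{i+1}$ are opposite vertices of $H_i$ (at distance $3$ in $H_i$). For a graph $G$ and an edge $e=uv$, $n_u(e,G)$ denotes the number of vertices of $G$ strictly closer to $u$ than to $v$ (and $n_v(e,G)$ analogously). The Mostar index is $Mo(G)=\sum_{uv\in E(G)}|n_u(uv,G)-n_v(uv,G)|$. For a vertex $w$ and an edge $f=ab$ put $d(w,f)=\min\{d(w,a),d(w,b)\}$; $m_u(e|G)$ is the number of edges $f$ of $G$ with $d(u,f)<d(v,f)$, and $m_v(e|G)$ analogously. The edge Mostar index is $Mo_e(G)=\sum_{e=uv\in E(G)}|m_u(e|G)-m_v(e|G)|$. -}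

module Defs where

open import Data.Nat using (ℕ; zero; suc; _+_; _*_; _≡ᵇ_; _<ᵇ_; ∣_-_∣; _⊔_)
open import Data.Bool using (Bool; true; false; _∧_; _∨_; if_then_else_)
open import Data.List using (List; []; _∷_; _++_; map; upTo; filterᵇ; length; concatMap)
open import Data.Bool.ListAction using (any)
open import Data.Nat.ListAction using (sum)
open import Data.Product using (_×_; _,_; proj₁; proj₂)

-- A finite simple graph given by its number of vertices (vertices 0 … N-1)
-- and its list of edges (unordered pairs, each listed once).
record Graph : Set where
  constructor mkGraph
  field
    nV    : ℕ
    edges : List (ℕ × ℕ)
open Graph public

vertices : Graph → List ℕ
vertices G = upTo (nV G)

adj : Graph → ℕ → ℕ → Bool
adj G u v = any (λ e → ((proj₁ e ≡ᵇ u) ∧ (proj₂ e ≡ᵇ v)) ∨ ((proj₁ e ≡ᵇ v) ∧ (proj₂ e ≡ᵇ u))) (edges G)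

elemᵇ : ℕ → List ℕ → Bool
elemᵇ x = any (λ y → x ≡ᵇ y)

step : Graph → List ℕ → List ℕ
step G r = filterᵇ (λ w → elemᵇ w r ∨ any (λ x → adj G x w) r) (vertices G)

ball : Graph → ℕ → ℕ → List ℕ
ball G u zero    = u ∷ []
ball G u (suc k) = step G (ball G u k)

within : Graph → ℕ → ℕ → ℕ → Bool
within G k u v = elemᵇ v (ball G u k)

firstWithin : Graph → ℕ → ℕ → ℕ → ℕ → ℕ
firstWithin G k zero       u v = k
firstWithin G k (suc fuel) u v = if within G k u v then k else firstWithin G (suc k) fuel u v

-- shortest-path distance (correct for connected graphs: every distance is < nV)
dist : Graph → ℕ → ℕ → ℕ
dist G u v = firstWithin G 0 (nV G) u v

nClose : Graph → ℕ → ℕ → ℕ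
nClose G u v = length (filterᵇ (λ w → dist G w u <ᵇ dist G w v) (vertices G))

Mo : Graph → ℕ
Mo G = sum (map (λ e → ∣ nClose G (proj₁ e) (proj₂ e) - nClose G (proj₂ e) (proj₁ e) ∣) (edges G))

distVE : Graph → ℕ → ℕ × ℕ → ℕ
distVE G w f = Data.Nat._⊓_ (dist G w (proj₁ f)) (dist G w (proj₂ f))

mClose : Graph → ℕ → ℕ → ℕ
mClose G u v = length (filterᵇ (λ f → distVE G u f <ᵇ distVE G v f) (edges G))

Moe : Graph → ℕ
Moe G = sum (map (λ e → ∣ mClose G (proj₁ e) (proj₂ e) - mClose G (proj₂ e) (proj₁ e) ∣) (edges G))

-- Edges of hexagon H_{i+1} (0-based i): cut vertices 5i and 5i+5 are opposite;
-- 5i – 5i+1 – 5i+2 – 5i+5 and 5i – 5i+3 – 5i+4 – 5i+5.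
hexEdges : ℕ → List (ℕ × ℕ)
hexEdges i = (b , b + 1) ∷ (b + 1 , b + 2) ∷ (b + 2 , b + 5)
           ∷ (b , b + 3) ∷ (b + 3 , b + 4) ∷ (b + 4 , b + 5) ∷ []
  where b = 5 * i

paraChain : ℕ → Graph
paraChain n = mkGraph (5 * n + 1) (concatMap hexEdges (upTo n))

-- Name the vertices of hexagon i by their place p on the 6-cycle, 0 and 3 being the cut
-- vertices shared with hexagons i - 1 and i + 1. Distances in L_n then have a closed form:
-- inside a hexagon they are distances on the 6-cycle, and from (i , p) to (j , q) with i < j a
-- shortest path runs through all cut vertices in between, so it has length
-- d(p , 3) + 3 (j - i - 1) + d(0 , q). This formula is 0 only at the source, changes by at most
-- one along an edge, and every vertex at distance m + 1 has a neighbour at distance m; these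
-- three properties force it to agree with the breadth-first distance of the graph.
--
-- Now take an edge ab of hexagon i with a nearer to the left cut vertex. Every vertex of an
-- earlier hexagon is closer to a, every vertex of a later one closer to b, and inside hexagon i
-- the split is 3 : 2; so n_a - n_b = 5 (i - (n - 1 - i)). Likewise every edge of an earlier
-- (later) hexagon is closer to a (b) and inside hexagon i the split is 2 : 2, giving
-- m_a - m_b = 6 (i - (n - 1 - i)). Summing over the 6 n edges, both indices are multiples
-- of the sum of |2i - (n - 1)| over i < n, which is 2k² for n = 2k and 2k² + 2k for n = 2k + 1.

module Submission where

open import Defs
open import Data.Nat using (ℕ; zero; suc; _+_; _*_; _≤_; _≥_; _<_; _∸_; _⊓_; _⊔_; ∣_-_∣; _≡ᵇ_; _≤ᵇ_; _<ᵇ_; s≤s; z≤n)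
open import Data.Nat.Properties hiding (_≟_)
open import Data.Nat.ListAction using (sum)
open import Data.Nat.ListAction.Properties using (sum-++)
open import Data.Nat.Tactic.RingSolver using (solve-∀)
open import Data.Bool using (Bool; T; T?; _∨_; _∧_; true; false)
open import Data.Bool.ListAction using (all; any)
open import Data.Bool.Properties using (T-∨; T-∧)
open import Data.Fin using (Fin; toℕ; _≟_)
open import Data.Fin.Patterns
open import Data.List using (List; []; _∷_; _++_; map; upTo; allFin; length; filterᵇ; concatMap)
open import Data.List.Properties using (map-cong-local; map-++; map-∘; map-applyUpTo; upTo-∷ʳ; length-upTo)
open import Data.List.Relation.Unary.All using (lookup; tabulate)
open import Data.List.Relation.Unary.All.Properties using (all⁺)
open import Data.List.Relation.Unary.Any as Any using (here; there)
open import Data.List.Relation.Unary.Any.Properties using (any⁺; any⁻)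
open import Data.List.Membership.Propositional using (_∈_; find)
open import Data.List.Membership.Propositional.Properties
  using (∈-filter⁺; ∈-filter⁻; ∈-upTo⁺; ∈-upTo⁻; ∈-allFin; ∈-map⁺; ∈-map⁻; ∈-concatMap⁺; ∈-concatMap⁻)
open import Data.Product using (_×_; _,_; proj₁; proj₂; map₁; ∃-syntax)
open import Data.Sum using (_⊎_; inj₁; inj₂)
open import Data.Unit using (tt)
open import Data.Empty using (⊥-elim)
open import Function using (_∘_; id; _⇔_; Equivalence; mk⇔)
open import Relation.Nullary using (¬_; contradiction)
open import Relation.Nullary.Decidable using (⌊_⌋; toWitness)
open import Relation.Binary.PropositionalEquality

record IsDistanceFrom (G : Graph) (u : ℕ) (d : ℕ → ℕ) : Set where
  field
    source      : u < nV G
    at-source   : d u ≡ 0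
    only-source : ∀ {v} → v < nV G → d v ≡ 0 → v ≡ u
    along-edge  : ∀ {x w} → T (adj G x w) → d w ≤ suc (d x)
    closer-neighbour : ∀ {w m} → w < nV G → d w ≡ suc m → ∃[ x ] (x < nV G × T (adj G x w) × d x ≡ m)
    bounded     : ∀ {v} → v < nV G → d v ≤ nV G

elemᵇ⇒∈ : ∀ {v xs} → T (elemᵇ v xs) → v ∈ xs
elemᵇ⇒∈ {v} {xs} t = Any.map (≡ᵇ⇒≡ v _) (any⁻ _ xs t)

∈⇒elemᵇ : ∀ {v xs} → v ∈ xs → T (elemᵇ v xs)
∈⇒elemᵇ {v} v∈xs = any⁺ _ (Any.map (λ { refl → ≡⇒≡ᵇ v v refl }) v∈xs)

module _ {G : Graph} {u : ℕ} {d : ℕ → ℕ} (isDist : IsDistanceFrom G u d) where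
  open IsDistanceFrom isDist

  ∈-ball⁻ : ∀ k {v} → v ∈ ball G u k → v < nV G × d v ≤ k
  ∈-ball⁻ zero (here refl) = source , ≤-reflexive at-source
  ∈-ball⁻ (suc k) v∈ball with ∈-filter⁻ (T? ∘ _) {xs = vertices G} v∈ball
  ... | v∈V , reached with Equivalence.to T-∨ reached
  ...   | inj₁ inBall = ∈-upTo⁻ v∈V , m≤n⇒m≤1+n (proj₂ (∈-ball⁻ k (elemᵇ⇒∈ inBall)))
  ...   | inj₂ viaNeighbour with find (any⁻ _ _ viaNeighbour)
  ...     | x , x∈ball , x~v = ∈-upTo⁻ v∈V , ≤-trans (along-edge x~v) (s≤s (proj₂ (∈-ball⁻ k x∈ball)))

  ∈-ball⁺ : ∀ k {v} → v < nV G → d v ≤ k → v ∈ ball G u k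
  ∈-ball⁺ zero v<N dv≤0 = here (only-source v<N (n≤0⇒n≡0 dv≤0))
  ∈-ball⁺ (suc k) {v} v<N dv≤1+k =
    ∈-filter⁺ (T? ∘ _) (∈-upTo⁺ v<N) (Equivalence.from T-∨ reached)
    where
    reached : T (elemᵇ v (ball G u k)) ⊎ T (any (λ x → adj G x v) (ball G u k))
    reached with m≤n⇒m<n∨m≡n dv≤1+k
    ... | inj₁ dv<1+k = inj₁ (∈⇒elemᵇ (∈-ball⁺ k v<N (≤-pred dv<1+k)))
    ... | inj₂ dv≡1+k with closer-neighbour v<N dv≡1+k
    ...   | x , x<N , x~v , dx≡k = inj₂ (any⁺ _ (Any.map (λ { refl → x~v }) (∈-ball⁺ k x<N (≤-reflexive dx≡k))))

  within⇔ : ∀ {v} → v < nV G → ∀ k → T (within G k u v) ⇔ d v ≤ k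
  within⇔ v<N k = mk⇔ (λ t → proj₂ (∈-ball⁻ k (elemᵇ⇒∈ t))) (λ dv≤k → ∈⇒elemᵇ (∈-ball⁺ k v<N dv≤k))

firstWithin≡ : ∀ {G u v} m → (∀ k → T (within G k u v) ⇔ m ≤ k) →
               ∀ fuel k → k ≤ m → m ≤ k + fuel → firstWithin G k fuel u v ≡ m
firstWithin≡ m within⇔ zero k k≤m m≤k+0 = ≤-antisym k≤m (subst (m ≤_) (+-identityʳ k) m≤k+0)
firstWithin≡ {G} {u} {v} m within⇔ (suc fuel) k k≤m m≤k+fuel with within G k u v in eq
... | true  = ≤-antisym k≤m (Equivalence.to (within⇔ k) (subst T (sym eq) _))
... | false with m≤n⇒m<n∨m≡n k≤m
...   | inj₁ k<m = firstWithin≡ m within⇔ fuel (suc k) k<m (subst (m ≤_) (+-suc k fuel) m≤k+fuel)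
...   | inj₂ refl = contradiction (Equivalence.from (within⇔ k) ≤-refl) (subst (λ b → ¬ T b) (sym eq) id)

dist≡ : ∀ {G u d} → IsDistanceFrom G u d → ∀ {v} → v < nV G → dist G u v ≡ d v
dist≡ {G} isDist {v} v<N =
  firstWithin≡ _ (within⇔ isDist v<N) (nV G) 0 z≤n (IsDistanceFrom.bounded isDist v<N)

bit : Bool → ℕ
bit true  = 1
bit false = 0

sumUpTo : ℕ → (ℕ → ℕ) → ℕ
sumUpTo n f = sum (map f (upTo n))

length-filterᵇ : ∀ {A : Set} (p : A → Bool) xs → length (filterᵇ p xs) ≡ sum (map (bit ∘ p) xs)
length-filterᵇ p []       = refl
length-filterᵇ p (x ∷ xs) with p x
... | true  = cong suc (length-filterᵇ p xs)
... | false = length-filterᵇ p xs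

sum-map-concatMap : ∀ {A B : Set} (f : B → ℕ) (g : A → List B) xs →
                    sum (map f (concatMap g xs)) ≡ sum (map (λ x → sum (map f (g x))) xs)
sum-map-concatMap f g []       = refl
sum-map-concatMap f g (x ∷ xs) = begin
  sum (map f (g x ++ concatMap g xs))              ≡⟨ cong sum (map-++ f (g x) _) ⟩
  sum (map f (g x) ++ map f (concatMap g xs))      ≡⟨ sum-++ (map f (g x)) _ ⟩
  sum (map f (g x)) + sum (map f (concatMap g xs)) ≡⟨ cong (sum (map f (g x)) +_) (sum-map-concatMap f g xs) ⟩
  sum (map f (g x)) + sum (map (λ y → sum (map f (g y))) xs) ∎
  where open ≡-Reasoning

sum-map-cong : ∀ {A : Set} {f g : A → ℕ} {xs} → (∀ {x} → x ∈ xs → f x ≡ g x) → sum (map f xs) ≡ sum (map g xs)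
sum-map-cong f≡g = cong sum (map-cong-local (tabulate f≡g))

sum-map-const : ∀ {A : Set} {f : A → ℕ} {c} xs → (∀ {x} → x ∈ xs → f x ≡ c) → sum (map f xs) ≡ length xs * c
sum-map-const []       f≡c = refl
sum-map-const (x ∷ xs) f≡c = cong₂ _+_ (f≡c (here refl)) (sum-map-const xs (f≡c ∘ there))

sum-map-*ˡ : ∀ {A : Set} c (f : A → ℕ) xs → sum (map (λ x → c * f x) xs) ≡ c * sum (map f xs)
sum-map-*ˡ c f []       = sym (*-zeroʳ c)
sum-map-*ˡ c f (x ∷ xs) = trans (cong (c * f x +_) (sum-map-*ˡ c f xs)) (sym (*-distribˡ-+ c (f x) _))

sumUpTo-suc : ∀ n f → sumUpTo (suc n) f ≡ sumUpTo n f + f n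
sumUpTo-suc n f = begin
  sum (map f (upTo (suc n)))       ≡⟨ cong (sum ∘ map f) (upTo-∷ʳ n) ⟨
  sum (map f (upTo n ++ n ∷ []))   ≡⟨ cong sum (map-++ f (upTo n) _) ⟩
  sum (map f (upTo n) ++ f n ∷ []) ≡⟨ sum-++ (map f (upTo n)) _ ⟩
  sumUpTo n f + (f n + 0)          ≡⟨ cong (sumUpTo n f +_) (+-identityʳ (f n)) ⟩
  sumUpTo n f + f n                ∎
  where open ≡-Reasoning

sumUpTo-sucˡ : ∀ n f → sumUpTo (suc n) f ≡ f 0 + sumUpTo n (f ∘ suc)
sumUpTo-sucˡ n f = cong (λ l → f 0 + sum l) (trans (map-applyUpTo suc f n) (sym (map-applyUpTo id (f ∘ suc) n)))

sumUpTo-+ : ∀ m k f → sumUpTo (m + k) f ≡ sumUpTo m f + sumUpTo k (λ t → f (m + t))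
sumUpTo-+ m zero    f = trans (cong (λ l → sumUpTo l f) (+-identityʳ m)) (sym (+-identityʳ _))
sumUpTo-+ m (suc k) f = begin
  sumUpTo (m + suc k) f                                   ≡⟨ cong (λ l → sumUpTo l f) (+-suc m k) ⟩
  sumUpTo (suc (m + k)) f                                 ≡⟨ sumUpTo-suc (m + k) f ⟩
  sumUpTo (m + k) f + f (m + k)                           ≡⟨ cong (_+ f (m + k)) (sumUpTo-+ m k f) ⟩
  sumUpTo m f + sumUpTo k (λ t → f (m + t)) + f (m + k)   ≡⟨ +-assoc (sumUpTo m f) _ _ ⟩
  sumUpTo m f + (sumUpTo k (λ t → f (m + t)) + f (m + k)) ≡⟨ cong (sumUpTo m f +_) (sumUpTo-suc k _) ⟨
  sumUpTo m f + sumUpTo (suc k) (λ t → f (m + t))         ∎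
  where open ≡-Reasoning

sumUpTo-const : ∀ k {f c} → (∀ {t} → t < k → f t ≡ c) → sumUpTo k f ≡ k * c
sumUpTo-const k f≡c = trans (sum-map-const (upTo k) (f≡c ∘ ∈-upTo⁻)) (cong (_* _) (length-upTo k))

sumUpTo-regions : ∀ {n i f A M C} → i < n → (∀ {j} → j < i → f j ≡ A) → f i ≡ M → (∀ {j} → i < j → f j ≡ C) →
                  sumUpTo n f ≡ i * A + M + (n ∸ suc i) * C
sumUpTo-regions {n} {i} {f} {A} {M} {C} i<n before at after = begin
  sumUpTo n f                                         ≡⟨ cong (λ m → sumUpTo m f) (m+[n∸m]≡n i<n) ⟨
  sumUpTo (suc i + d) f                               ≡⟨ sumUpTo-+ (suc i) d f ⟩
  sumUpTo (suc i) f + sumUpTo d (λ t → f (suc i + t)) ≡⟨ cong (_+ sumUpTo d (λ t → f (suc i + t))) (sumUpTo-suc i f) ⟩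
  sumUpTo i f + f i + sumUpTo d (λ t → f (suc i + t)) ≡⟨ cong₂ (λ x y → x + f i + y) (sumUpTo-const i before)
                                                                 (sumUpTo-const d (λ {t} _ → after (s≤s (m≤m+n i t)))) ⟩
  i * A + f i + d * C                                      ≡⟨ cong (λ m → i * A + m + d * C) at ⟩
  i * A + M + d * C                                        ∎
  where
  open ≡-Reasoning
  d : ℕ
  d = n ∸ suc i

∸-suc : ∀ {i n} → i < n → n ∸ i ≡ suc (n ∸ suc i)
∸-suc {zero}  {suc n} _         = refl
∸-suc {suc i} {suc n} (s≤s i<n) = ∸-suc i<n

<ᵇ-cancelˡ : ∀ c a b → ((c + a) <ᵇ (c + b)) ≡ (a <ᵇ b)
<ᵇ-cancelˡ zero    a b = refl
<ᵇ-cancelˡ (suc c) a b = <ᵇ-cancelˡ c a b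

<ᵇ-cancelʳ : ∀ c a b → ((a + c) <ᵇ (b + c)) ≡ (a <ᵇ b)
<ᵇ-cancelʳ c a b = trans (cong₂ _<ᵇ_ (+-comm a c) (+-comm b c)) (<ᵇ-cancelˡ c a b)

bit-n<ᵇ1+n : ∀ m → bit (m <ᵇ suc m) ≡ 1
bit-n<ᵇ1+n zero    = refl
bit-n<ᵇ1+n (suc m) = bit-n<ᵇ1+n m

bit-1+n<ᵇn : ∀ m → bit (suc m <ᵇ m) ≡ 0
bit-1+n<ᵇn zero    = refl
bit-1+n<ᵇn (suc m) = bit-1+n<ᵇn m

-- Positions on a hexagon, numbered around the cycle; 0F and 3F are its cut vertices.
Pos : Set
Pos = Fin 6

hexDist : Pos → Pos → ℕ
hexDist p q = ∣ toℕ p - toℕ q ∣ ⊓ (6 ∸ ∣ toℕ p - toℕ q ∣)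

hexagon : List (Pos × Pos)
hexagon = (0F , 1F) ∷ (1F , 2F) ∷ (2F , 3F) ∷ (0F , 5F) ∷ (5F , 4F) ∷ (4F , 3F) ∷ []

Adjacent : Pos → Pos → Set
Adjacent p q = (p , q) ∈ hexagon ⊎ (q , p) ∈ hexagon

-- Facts about a single hexagon are proved by evaluating a Boolean check over all positions.
holds : ∀ {A : Set} (f : A → Bool) {xs} → T (all f xs) → ∀ {x} → x ∈ xs → T (f x)
holds f {xs} t = lookup (all⁺ f xs t)

everywhere : (f : Pos → Bool) → T (all f (allFin 6)) → ∀ p → T (f p)
everywhere f t p = holds f t (∈-allFin p)

everywhere₂ : (f : Pos → Pos → Bool) → T (all (λ p → all (f p) (allFin 6)) (allFin 6)) → ∀ p q → T (f p q)
everywhere₂ f t p q = holds (f p) (everywhere (λ p → all (f p) (allFin 6)) t p) (∈-allFin q)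

hexDist-refl : ∀ p → hexDist p p ≡ 0
hexDist-refl p = cong (λ d → d ⊓ (6 ∸ d)) (∣n-n∣≡0 (toℕ p))

hexDist-comm : ∀ p q → hexDist p q ≡ hexDist q p
hexDist-comm p q = cong (λ d → d ⊓ (6 ∸ d)) (∣-∣-comm (toℕ p) (toℕ q))

hexDist-step : ∀ r {p q} → Adjacent p q → hexDist r q ≤ suc (hexDist r p)
hexDist-step r {p} {q} p~q = ≤ᵇ⇒≤ (hexDist r q) (suc (hexDist r p)) (along p~q)
  where
  stepsOK : Pos → Pos × Pos → Bool
  stepsOK r (a , b) = (hexDist r b ≤ᵇ suc (hexDist r a)) ∧ (hexDist r a ≤ᵇ suc (hexDist r b))
  edgeOK : ∀ {e} → e ∈ hexagon → T (stepsOK r e)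
  edgeOK = holds (stepsOK r) (everywhere (λ r → all (stepsOK r) hexagon) tt r)
  along : Adjacent p q → T (hexDist r q ≤ᵇ suc (hexDist r p))
  along (inj₁ e) = proj₁ (Equivalence.to T-∧ (edgeOK e))
  along (inj₂ e) = proj₂ (Equivalence.to T-∧ (edgeOK e))

hexDist-stepʳ : ∀ r {p q} → Adjacent p q → hexDist q r ≤ suc (hexDist p r)
hexDist-stepʳ r {p} {q} p~q = subst₂ (λ a b → a ≤ suc b) (hexDist-comm r q) (hexDist-comm r p) (hexDist-step r p~q)

closerNeighbour : Pos → Pos → Pos × Pos → Bool
closerNeighbour r q (a , b) =
  (⌊ b ≟ q ⌋ ∧ (suc (hexDist r a) ≡ᵇ hexDist r q)) ∨ (⌊ a ≟ q ⌋ ∧ (suc (hexDist r b) ≡ᵇ hexDist r q))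

closerNeighbour-sound : ∀ r q {e} → e ∈ hexagon → T (closerNeighbour r q e) →
                        ∃[ p ] (Adjacent p q × suc (hexDist r p) ≡ hexDist r q)
closerNeighbour-sound r q {a , b} e t with Equivalence.to T-∨ t
... | inj₁ t′ with Equivalence.to T-∧ t′
...   | b≡q , d with refl ← toWitness {a? = b ≟ q} b≡q = a , inj₁ e , ≡ᵇ⇒≡ _ _ d
closerNeighbour-sound r q {a , b} e t | inj₂ t′ with Equivalence.to T-∧ t′
...   | a≡q , d with refl ← toWitness {a? = a ≟ q} a≡q = b , inj₂ e , ≡ᵇ⇒≡ _ _ d

hexDist-pred : ∀ r q → r ≡ q ⊎ ∃[ p ] (Adjacent p q × suc (hexDist r p) ≡ hexDist r q)
hexDist-pred r q with Equivalence.to T-∨ (everywhere₂ found tt r q)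
  where
  found : Pos → Pos → Bool
  found r q = ⌊ r ≟ q ⌋ ∨ any (closerNeighbour r q) hexagon
... | inj₁ r≡q = inj₁ (toWitness {a? = r ≟ q} r≡q)
... | inj₂ t with find (any⁻ _ hexagon t)
...   | _ , e , c = inj₂ (closerNeighbour-sound r q e c)

hexDist-predʳ : ∀ q r → q ≡ r ⊎ ∃[ p ] (Adjacent p q × suc (hexDist p r) ≡ hexDist q r)
hexDist-predʳ q r with hexDist-pred r q
... | inj₁ refl = inj₁ refl
... | inj₂ (p , p~q , closer) = inj₂ (p , p~q , subst₂ (λ a b → suc a ≡ b) (hexDist-comm r p) (hexDist-comm r q) closer)

hexDist-zero : ∀ r q → hexDist r q ≡ 0 → r ≡ q
hexDist-zero r q d≡0 with hexDist-pred r q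
... | inj₁ r≡q = r≡q
... | inj₂ (_ , _ , 1+d≡0) = ⊥-elim (1+n≢0 (trans 1+d≡0 d≡0))

onEdges : (lhs rhs : Pos → Pos → ℕ) → T (all (λ e → lhs (proj₁ e) (proj₂ e) ≡ᵇ rhs (proj₁ e) (proj₂ e)) hexagon) →
          ∀ {a b} → (a , b) ∈ hexagon → lhs a b ≡ rhs a b
onEdges lhs rhs t {a} {b} e = ≡ᵇ⇒≡ (lhs a b) (rhs a b) (holds (λ e → lhs (proj₁ e) (proj₂ e) ≡ᵇ rhs (proj₁ e) (proj₂ e)) t e)

hexDist≤3 : ∀ p q → hexDist p q ≤ 3
hexDist≤3 p q = ≤ᵇ⇒≤ _ 3 (everywhere₂ (λ p q → hexDist p q ≤ᵇ 3) tt p q)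

hexagon-oriented : ∀ {a b} → (a , b) ∈ hexagon → suc (hexDist 0F a) ≡ hexDist 0F b × suc (hexDist b 3F) ≡ hexDist a 3F
hexagon-oriented e =
  onEdges (λ a _ → suc (hexDist 0F a)) (λ _ b → hexDist 0F b) tt e , onEdges (λ _ b → suc (hexDist b 3F)) (λ a _ → hexDist a 3F) tt e

-- Vertices 5i, …, 5i+4 of hexagon i: its right cut vertex is counted with hexagon i + 1.
block : List Pos
block = 0F ∷ 1F ∷ 2F ∷ 5F ∷ 4F ∷ []

hexDistToEdge : Pos → Pos × Pos → ℕ
hexDistToEdge a (c , d) = hexDist a c ⊓ hexDist a d

nearerInHexagon : Pos → Pos → ℕ
nearerInHexagon a b = sum (map (λ r → bit (hexDist r a <ᵇ hexDist r b)) block)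

nearerEdgesInHexagon : Pos → Pos → ℕ
nearerEdgesInHexagon a b = sum (map (λ f → bit (hexDistToEdge a f <ᵇ hexDistToEdge b f)) hexagon)

nearerInHexagon-edge : ∀ {a b} → (a , b) ∈ hexagon → nearerInHexagon a b ≡ 3 × nearerInHexagon b a ≡ 2
nearerInHexagon-edge e = onEdges nearerInHexagon (λ _ _ → 3) tt e , onEdges (λ a b → nearerInHexagon b a) (λ _ _ → 2) tt e

nearerEdgesInHexagon-edge : ∀ {a b} → (a , b) ∈ hexagon → nearerEdgesInHexagon a b ≡ 2 × nearerEdgesInHexagon b a ≡ 2
nearerEdgesInHexagon-edge e =
  onEdges nearerEdgesInHexagon (λ _ _ → 2) tt e , onEdges (λ a b → nearerEdgesInHexagon b a) (λ _ _ → 2) tt e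

Site : Set
Site = ℕ × Pos

span : ℕ → ℕ
span zero    = 0
span (suc k) = 3 + span k

siteDist : Site → Site → ℕ
siteDist (zero  , p) (zero  , q) = hexDist p q
siteDist (zero  , p) (suc j , q) = hexDist p 3F + span j + hexDist 0F q
siteDist (suc i , p) (zero  , q) = hexDist 0F p + span i + hexDist q 3F
siteDist (suc i , p) (suc j , q) = siteDist (i , p) (j , q)

vertex : ℕ → Pos → ℕ
vertex i 0F = 5 * i
vertex i 1F = 5 * i + 1
vertex i 2F = 5 * i + 2
vertex i 3F = 5 * i + 5
vertex i 4F = 5 * i + 4
vertex i 5F = 5 * i + 3

vertex-suc : ∀ i p → vertex (suc i) p ≡ 5 + vertex i p
vertex-suc i 0F = *-suc 5 i
vertex-suc i 1F = trans (cong (_+ 1) (*-suc 5 i)) (+-assoc 5 (5 * i) 1)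
vertex-suc i 2F = trans (cong (_+ 2) (*-suc 5 i)) (+-assoc 5 (5 * i) 2)
vertex-suc i 3F = trans (cong (_+ 5) (*-suc 5 i)) (+-assoc 5 (5 * i) 5)
vertex-suc i 4F = trans (cong (_+ 4) (*-suc 5 i)) (+-assoc 5 (5 * i) 4)
vertex-suc i 5F = trans (cong (_+ 3) (*-suc 5 i)) (+-assoc 5 (5 * i) 3)

vertex-cut : ∀ i → vertex i 3F ≡ vertex (suc i) 0F
vertex-cut i = trans (+-comm (5 * i) 5) (sym (*-suc 5 i))

swap-ends : ∀ a s b → a + s + b ≡ b + s + a
swap-ends = solve-∀

siteDist-comm : ∀ s t → siteDist s t ≡ siteDist t s
siteDist-comm (zero  , p) (zero  , q) = hexDist-comm p q
siteDist-comm (zero  , p) (suc j , q) = swap-ends (hexDist p 3F) (span j) (hexDist 0F q)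
siteDist-comm (suc i , p) (zero  , q) = swap-ends (hexDist 0F p) (span i) (hexDist q 3F)
siteDist-comm (suc i , p) (suc j , q) = siteDist-comm (i , p) (j , q)

siteDist-same : ∀ i p q → siteDist (i , p) (i , q) ≡ hexDist p q
siteDist-same zero    p q = refl
siteDist-same (suc i) p q = siteDist-same i p q

siteDist-before : ∀ {j i} r q → j < i → siteDist (j , r) (i , q) ≡ hexDist r 3F + span (i ∸ suc j) + hexDist 0F q
siteDist-before {zero}  {suc i} r q _ = refl
siteDist-before {suc j} {suc i} r q (s≤s j<i) = siteDist-before r q j<i

siteDist-after : ∀ {j i} r q → i < j → siteDist (j , r) (i , q) ≡ hexDist 0F r + span (j ∸ suc i) + hexDist q 3F
siteDist-after {suc j} {zero}  r q _ = refl
siteDist-after {suc j} {suc i} r q (s≤s i<j) = siteDist-after r q i<j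

+0+0 : ∀ a → a + 0 + 0 ≡ a
+0+0 = solve-∀

+3≡3+ : ∀ a s → a + s + 3 ≡ a + (3 + s) + 0
+3≡3+ = solve-∀

siteDist-cut : ∀ s i → siteDist s (i , 3F) ≡ siteDist s (suc i , 0F)
siteDist-cut (zero  , r)     zero    = sym (+0+0 _)
siteDist-cut (zero  , r)     (suc i) = +3≡3+ (hexDist r 3F) (span i)
siteDist-cut (suc zero , r)  zero    = trans (+0+0 (hexDist 0F r)) (hexDist-comm 0F r)
siteDist-cut (suc (suc j) , r) zero  = sym (+3≡3+ (hexDist 0F r) (span j))
siteDist-cut (suc j , r) (suc i) = siteDist-cut (j , r) i

siteDist-step : ∀ s i {p q} → Adjacent p q → siteDist s (i , q) ≤ suc (siteDist s (i , p))
siteDist-step (zero  , r) zero    p~q = hexDist-step r p~q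
siteDist-step (zero  , r) (suc i) p~q =
  ≤-trans (+-monoʳ-≤ (hexDist r 3F + span i) (hexDist-step 0F p~q)) (≤-reflexive (+-suc _ _))
siteDist-step (suc j , r) zero    p~q =
  ≤-trans (+-monoʳ-≤ (hexDist 0F r + span j) (hexDist-stepʳ 3F p~q)) (≤-reflexive (+-suc _ _))
siteDist-step (suc j , r) (suc i) p~q = siteDist-step (j , r) i p~q

siteDist-zero : ∀ j r i q → siteDist (j , r) (i , q) ≡ 0 → vertex j r ≡ vertex i q
siteDist-zero zero    r zero    q d≡0 = cong (vertex 0) (hexDist-zero r q d≡0)
siteDist-zero zero r (suc zero) q d≡0
  with hexDist-zero r 3F (m+n≡0⇒m≡0 (hexDist r 3F) (m+n≡0⇒m≡0 (hexDist r 3F + 0) d≡0))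
     | hexDist-zero 0F q (m+n≡0⇒n≡0 (hexDist r 3F + 0) d≡0)
... | refl | refl = refl
siteDist-zero zero r (suc (suc i)) q d≡0
  with () ← m+n≡0⇒n≡0 (hexDist r 3F) (m+n≡0⇒m≡0 (hexDist r 3F + (3 + span i)) d≡0)
siteDist-zero (suc zero) r zero q d≡0
  with hexDist-zero 0F r (m+n≡0⇒m≡0 (hexDist 0F r) (m+n≡0⇒m≡0 (hexDist 0F r + 0) d≡0))
     | hexDist-zero q 3F (m+n≡0⇒n≡0 (hexDist 0F r + 0) d≡0)
... | refl | refl = refl
siteDist-zero (suc (suc j)) r zero q d≡0
  with () ← m+n≡0⇒n≡0 (hexDist 0F r) (m+n≡0⇒m≡0 (hexDist 0F r + (3 + span j)) d≡0)
siteDist-zero (suc j) r (suc i) q d≡0 =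
  trans (vertex-suc j r) (trans (cong (5 +_) (siteDist-zero j r i q d≡0)) (sym (vertex-suc i q)))

3+s+3 : ∀ s → 3 + s + 3 ≡ 3 + (3 + s)
3+s+3 = solve-∀

siteDist-bound : ∀ j r i q → siteDist (j , r) (i , q) ≤ span (suc (j ⊔ i))
siteDist-bound zero    r zero    q = hexDist≤3 r q
siteDist-bound zero    r (suc i) q =
  ≤-trans (+-mono-≤ (+-monoˡ-≤ (span i) (hexDist≤3 r 3F)) (hexDist≤3 0F q)) (≤-reflexive (3+s+3 (span i)))
siteDist-bound (suc j) r zero    q =
  ≤-trans (+-mono-≤ (+-monoˡ-≤ (span j) (hexDist≤3 0F r)) (hexDist≤3 q 3F)) (≤-reflexive (3+s+3 (span j)))
siteDist-bound (suc j) r (suc i) q = ≤-trans (siteDist-bound j r i q) (m≤n+m _ 3)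

record Predecessor (n : ℕ) (s : Site) (w m : ℕ) : Set where
  constructor predecessor
  field
    hex      : ℕ
    from to  : Pos
    hex<n    : hex < n
    adjacent : Adjacent from to
    lands    : vertex hex to ≡ w
    closer   : siteDist s (hex , from) ≡ m

shiftPredecessor : ∀ {n j r w m} → Predecessor n (j , r) w m → Predecessor (suc n) (suc j , r) (5 + w) m
shiftPredecessor (predecessor k p q k<n p~q refl d) = predecessor (suc k) p q (s≤s k<n) p~q (vertex-suc k q) d

one-step-back : ∀ c {a b m} → suc a ≡ b → c + b ≡ suc m → c + a ≡ m
one-step-back c {a} a+1≡b c+b≡1+m = suc-injective (trans (trans (sym (+-suc c a)) (cong (c +_) a+1≡b)) c+b≡1+m)

-- When the target is a cut vertex with no closer neighbour in its own hexagon, it is renamed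
-- as a vertex of the adjacent hexagon (siteDist-cut) and the search continues there.
siteDist-pred : ∀ {n} j r i q {m} → j < n → i < n → siteDist (j , r) (i , q) ≡ suc m →
                Predecessor n (j , r) (vertex i q) m
siteDist-pred zero r zero q j<n i<n d≡1+m with hexDist-pred r q
... | inj₁ refl = ⊥-elim (1+n≢0 (trans (sym d≡1+m) (hexDist-refl r)))
... | inj₂ (p , p~q , closer) = predecessor 0 p q i<n p~q refl (suc-injective (trans closer d≡1+m))
siteDist-pred {n} zero r (suc i) q {m} j<n i<n d≡1+m with hexDist-pred 0F q
... | inj₁ refl = subst (λ w → Predecessor n (zero , r) w m) (vertex-cut i)
      (siteDist-pred zero r i 3F j<n (<-trans (n<1+n i) i<n) (trans (siteDist-cut (zero , r) i) d≡1+m))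
... | inj₂ (p , p~q , closer) = predecessor (suc i) p q i<n p~q refl (one-step-back (hexDist r 3F + span i) closer d≡1+m)
siteDist-pred {suc n} (suc j) r zero q (s≤s j<n) i<n d≡1+m with hexDist-predʳ q 3F
... | inj₁ refl = shiftPredecessor (siteDist-pred j r zero 0F j<n (≤-trans (s≤s z≤n) j<n)
                    (trans (sym (siteDist-cut (suc j , r) zero)) d≡1+m))
... | inj₂ (p , p~q , closer) = predecessor 0 p q i<n p~q refl (one-step-back (hexDist 0F r + span j) closer d≡1+m)
siteDist-pred {suc n} (suc j) r (suc i) q {m} (s≤s j<n) (s≤s i<n) d≡1+m =
  subst (λ w → Predecessor (suc n) (suc j , r) w m) (sym (vertex-suc i q)) (shiftPredecessor (siteDist-pred j r i q j<n i<n d≡1+m))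

inHexagon : ℕ → Pos × Pos → ℕ × ℕ
inHexagon i (p , q) = vertex i p , vertex i q

∈-edges : ∀ {n i p q} → i < n → (p , q) ∈ hexagon → (vertex i p , vertex i q) ∈ edges (paraChain n)
∈-edges i<n e = ∈-concatMap⁺ hexEdges (Any.map (λ { refl → ∈-map⁺ (inHexagon _) e }) (∈-upTo⁺ i<n))

≡ᵇ-refl₂ : ∀ x y → T ((x ≡ᵇ x) ∧ (y ≡ᵇ y))
≡ᵇ-refl₂ x y = Equivalence.from T-∧ (≡⇒≡ᵇ x x refl , ≡⇒≡ᵇ y y refl)

adjacent⇒adj : ∀ {n i p q} → i < n → Adjacent p q → T (adj (paraChain n) (vertex i p) (vertex i q))
adjacent⇒adj {i = i} {p} {q} i<n (inj₁ e) =
  any⁺ _ (Any.map (λ { refl → Equivalence.from T-∨ (inj₁ (≡ᵇ-refl₂ (vertex i p) (vertex i q))) }) (∈-edges i<n e))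
adjacent⇒adj {i = i} {p} {q} i<n (inj₂ e) =
  any⁺ _ (Any.map (λ { refl → Equivalence.from T-∨ (inj₂ (≡ᵇ-refl₂ (vertex i q) (vertex i p))) }) (∈-edges i<n e))

adj⇒adjacent : ∀ {n x w} → T (adj (paraChain n) x w) →
               ∃[ i ] ∃[ p ] ∃[ q ] (i < n × Adjacent p q × x ≡ vertex i p × w ≡ vertex i q)
adj⇒adjacent {n} t with find (any⁻ _ (edges (paraChain n)) t)
... | e , e∈E , matches with find (∈-concatMap⁻ hexEdges {xs = upTo n} e∈E)
...   | i , i∈upTo , e∈hex with ∈-map⁻ (inHexagon i) e∈hex
...     | (p , q) , e′ , refl with Equivalence.to T-∨ matches
...       | inj₁ m = i , p , q , ∈-upTo⁻ i∈upTo , inj₁ e′ ,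
                     sym (≡ᵇ⇒≡ _ _ (proj₁ (Equivalence.to T-∧ m))) , sym (≡ᵇ⇒≡ _ _ (proj₂ (Equivalence.to T-∧ m)))
...       | inj₂ m = i , q , p , ∈-upTo⁻ i∈upTo , inj₂ e′ ,
                     sym (≡ᵇ⇒≡ _ _ (proj₂ (Equivalence.to T-∧ m))) , sym (≡ᵇ⇒≡ _ _ (proj₁ (Equivalence.to T-∧ m)))

vertex≤ : ∀ i p → vertex i p ≤ 5 * i + 5
vertex≤ i 0F = m≤m+n (5 * i) 5
vertex≤ i 1F = +-monoʳ-≤ (5 * i) (≤ᵇ⇒≤ 1 5 tt)
vertex≤ i 2F = +-monoʳ-≤ (5 * i) (≤ᵇ⇒≤ 2 5 tt)
vertex≤ i 3F = ≤-refl
vertex≤ i 4F = +-monoʳ-≤ (5 * i) (≤ᵇ⇒≤ 4 5 tt)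
vertex≤ i 5F = +-monoʳ-≤ (5 * i) (≤ᵇ⇒≤ 3 5 tt)

vertex< : ∀ {n i} p → i < n → vertex i p < 5 * n + 1
vertex< {n} {i} p i<n = ≤-<-trans (≤-trans (vertex≤ i p) hexagon-i≤) (m<m+n (5 * n) (s≤s z≤n))
  where
  hexagon-i≤ : 5 * i + 5 ≤ 5 * n
  hexagon-i≤ = ≤-trans (≤-reflexive (trans (+-comm (5 * i) 5) (sym (*-suc 5 i)))) (*-monoʳ-≤ 5 i<n)

5*[1+n]+1 : ∀ n → 5 * suc n + 1 ≡ 5 + (5 * n + 1)
5*[1+n]+1 = solve-∀

vertex-onto : ∀ n {w} → w < 5 * suc n + 1 → ∃[ i ] ∃[ p ] (i < suc n × vertex i p ≡ w)
vertex-onto n {0} _ = 0 , 0F , s≤s z≤n , refl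
vertex-onto n {1} _ = 0 , 1F , s≤s z≤n , refl
vertex-onto n {2} _ = 0 , 2F , s≤s z≤n , refl
vertex-onto n {3} _ = 0 , 5F , s≤s z≤n , refl
vertex-onto n {4} _ = 0 , 4F , s≤s z≤n , refl
vertex-onto zero    {suc (suc (suc (suc (suc zero))))} _ = 0 , 3F , s≤s z≤n , refl
vertex-onto zero    {suc (suc (suc (suc (suc (suc w)))))} (s≤s (s≤s (s≤s (s≤s (s≤s (s≤s ()))))))
vertex-onto (suc n) {suc (suc (suc (suc (suc w))))} w<N
  with i , p , i<n , refl ← vertex-onto n (+-cancelˡ-< 5 _ _ (subst (5 + w <_) (5*[1+n]+1 (suc n)) w<N))
  = suc i , p , s≤s i<n , vertex-suc i p

-- The cut vertex 5i + 5 has the two names (i , 3F) and (i + 1 , 0F); locate always picks the second.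
canonical : Site → Site
canonical (i , 3F) = suc i , 0F
canonical s        = s

locate : ℕ → Site
locate 0 = 0 , 0F
locate 1 = 0 , 1F
locate 2 = 0 , 2F
locate 3 = 0 , 5F
locate 4 = 0 , 4F
locate (suc (suc (suc (suc (suc w))))) = map₁ suc (locate w)

locate-vertex : ∀ i p → locate (vertex i p) ≡ canonical (i , p)
locate-vertex zero 0F = refl
locate-vertex zero 1F = refl
locate-vertex zero 2F = refl
locate-vertex zero 3F = refl
locate-vertex zero 4F = refl
locate-vertex zero 5F = refl
locate-vertex (suc i) p = trans (cong locate (vertex-suc i p)) (trans (cong (map₁ suc) (locate-vertex i p)) (suc-canonical p))
  where
  suc-canonical : ∀ p → map₁ suc (canonical (i , p)) ≡ canonical (suc i , p)
  suc-canonical 0F = refl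
  suc-canonical 1F = refl
  suc-canonical 2F = refl
  suc-canonical 3F = refl
  suc-canonical 4F = refl
  suc-canonical 5F = refl

siteDist-canonical : ∀ s t → siteDist (canonical s) t ≡ siteDist s t
siteDist-canonical (i , 0F) t = refl
siteDist-canonical (i , 1F) t = refl
siteDist-canonical (i , 2F) t = refl
siteDist-canonical (i , 3F) t = sym (trans (siteDist-comm (i , 3F) t) (trans (siteDist-cut t i) (siteDist-comm t (suc i , 0F))))
siteDist-canonical (i , 4F) t = refl
siteDist-canonical (i , 5F) t = refl

δ : ℕ → ℕ → ℕ
δ u v = siteDist (locate u) (locate v)

δ-vertex : ∀ j r i q → δ (vertex j r) (vertex i q) ≡ siteDist (j , r) (i , q)
δ-vertex j r i q = begin
  siteDist (locate (vertex j r)) (locate (vertex i q)) ≡⟨ cong₂ siteDist (locate-vertex j r) (locate-vertex i q) ⟩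
  siteDist (canonical (j , r)) (canonical (i , q))     ≡⟨ siteDist-canonical (j , r) _ ⟩
  siteDist (j , r) (canonical (i , q))                 ≡⟨ siteDist-comm (j , r) _ ⟩
  siteDist (canonical (i , q)) (j , r)                 ≡⟨ siteDist-canonical (i , q) _ ⟩
  siteDist (i , q) (j , r)                             ≡⟨ siteDist-comm (i , q) _ ⟩
  siteDist (j , r) (i , q)                             ∎
  where open ≡-Reasoning

span-mono : ∀ {m n} → m ≤ n → span m ≤ span n
span-mono z≤n       = z≤n
span-mono (s≤s m≤n) = +-monoʳ-≤ 3 (span-mono m≤n)

span≤5* : ∀ n → span n ≤ 5 * n
span≤5* zero    = z≤n
span≤5* (suc n) = ≤-trans (+-mono-≤ (≤ᵇ⇒≤ 3 5 tt) (span≤5* n)) (≤-reflexive (sym (*-suc 5 n)))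

isDistanceFrom : ∀ n {u} → u < 5 * suc n + 1 → IsDistanceFrom (paraChain (suc n)) u (δ u)
isDistanceFrom n u<N with j , r , j<n , refl ← vertex-onto n u<N = record
  { source      = u<N
  ; at-source   = trans (δ-vertex j r j r) (trans (siteDist-same j r r) (hexDist-refl r))
  ; only-source = only-source
  ; along-edge  = along-edge
  ; closer-neighbour = closer-neighbour
  ; bounded     = bounded
  }
  where
  only-source : ∀ {v} → v < 5 * suc n + 1 → δ (vertex j r) v ≡ 0 → v ≡ vertex j r
  only-source v<N d≡0 with i , q , _ , refl ← vertex-onto n v<N =
    sym (siteDist-zero j r i q (trans (sym (δ-vertex j r i q)) d≡0))

  along-edge : ∀ {x w} → T (adj (paraChain (suc n)) x w) → δ (vertex j r) w ≤ suc (δ (vertex j r) x)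
  along-edge {x} {w} x~w with i , p , q , _ , p~q , refl , refl ← adj⇒adjacent {suc n} {x} {w} x~w
    rewrite δ-vertex j r i q | δ-vertex j r i p = siteDist-step (j , r) i p~q

  closer-neighbour : ∀ {w m} → w < 5 * suc n + 1 → δ (vertex j r) w ≡ suc m →
                 ∃[ x ] (x < 5 * suc n + 1 × T (adj (paraChain (suc n)) x w) × δ (vertex j r) x ≡ m)
  closer-neighbour w<N d≡1+m with i , q , i<n , refl ← vertex-onto n w<N
    with predecessor k p q′ k<n p~q′ lands closer ← siteDist-pred j r i q j<n i<n (trans (sym (δ-vertex j r i q)) d≡1+m)
    = vertex k p , vertex< p k<n , subst (λ w → T (adj (paraChain (suc n)) (vertex k p) w)) lands (adjacent⇒adj k<n p~q′) ,
      trans (δ-vertex j r k p) closer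

  bounded : ∀ {v} → v < 5 * suc n + 1 → δ (vertex j r) v ≤ 5 * suc n + 1
  bounded v<N with i , q , i<n , refl ← vertex-onto n v<N = begin
    δ (vertex j r) (vertex i q) ≡⟨ δ-vertex j r i q ⟩
    siteDist (j , r) (i , q)    ≤⟨ siteDist-bound j r i q ⟩
    span (suc (j ⊔ i))          ≤⟨ span-mono (⊔-lub j<n i<n) ⟩
    span (suc n)                ≤⟨ span≤5* (suc n) ⟩
    5 * suc n                   ≤⟨ m≤m+n (5 * suc n) 1 ⟩
    5 * suc n + 1               ∎
    where open ≤-Reasoning

dist-vertex : ∀ {n} j r i q → 1 ≤ n → vertex j r < 5 * n + 1 → vertex i q < 5 * n + 1 →
              dist (paraChain n) (vertex j r) (vertex i q) ≡ siteDist (j , r) (i , q)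
dist-vertex {suc n} j r i q _ u<N v<N = trans (dist≡ (isDistanceFrom n u<N) v<N) (δ-vertex j r i q)

sumUpTo-blocks : ∀ n g → sumUpTo (5 * n) g ≡ sumUpTo n (λ j → sum (map (g ∘ vertex j) block))
sumUpTo-blocks zero    g = refl
sumUpTo-blocks (suc n) g = begin
  sumUpTo (5 * suc n) g                               ≡⟨ cong (λ m → sumUpTo m g) (trans (*-suc 5 n) (+-comm 5 (5 * n))) ⟩
  sumUpTo (5 * n + 5) g                               ≡⟨ sumUpTo-+ (5 * n) 5 g ⟩
  sumUpTo (5 * n) g + sumUpTo 5 (λ t → g (5 * n + t)) ≡⟨ cong₂ _+_ (sumUpTo-blocks n g)
                                                                   (cong (_+ sumUpTo 4 (λ t → g (5 * n + suc t))) (cong g (+-identityʳ (5 * n)))) ⟩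
  sumUpTo n (λ j → sum (map (g ∘ vertex j) block)) + sum (map (g ∘ vertex n) block) ≡⟨ sumUpTo-suc n _ ⟨
  sumUpTo (suc n) (λ j → sum (map (g ∘ vertex j) block))                            ∎
  where open ≡-Reasoning

sumUpTo-vertices : ∀ n g → sumUpTo (5 * n + 1) g ≡ sumUpTo n (λ j → sum (map (g ∘ vertex j) block)) + g (vertex n 0F)
sumUpTo-vertices n g = begin
  sumUpTo (5 * n + 1) g                   ≡⟨ sumUpTo-+ (5 * n) 1 g ⟩
  sumUpTo (5 * n) g + (g (5 * n + 0) + 0) ≡⟨ cong₂ _+_ (sumUpTo-blocks n g) (trans (+-identityʳ _) (cong g (+-identityʳ (5 * n)))) ⟩
  sumUpTo n (λ j → sum (map (g ∘ vertex j) block)) + g (vertex n 0F) ∎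
  where open ≡-Reasoning

nearer : Site → Site → Site → ℕ
nearer s x y = bit (siteDist s x <ᵇ siteDist s y)

distToEdge : Site → ℕ → Pos × Pos → ℕ
distToEdge s j (c , d) = siteDist s (j , c) ⊓ siteDist s (j , d)

nearerEdge : Site → Site → ℕ → Pos × Pos → ℕ
nearerEdge x y j f = bit (distToEdge x j f <ᵇ distToEdge y j f)

nClose-vertex : ∀ {n i a k b} → 1 ≤ n → vertex i a < 5 * n + 1 → vertex k b < 5 * n + 1 →
                nClose (paraChain n) (vertex i a) (vertex k b) ≡
                sumUpTo n (λ j → sum (map (λ r → nearer (j , r) (i , a) (k , b)) block)) + nearer (n , 0F) (i , a) (k , b)
nClose-vertex {n} {i} {a} {k} {b} 1≤n x<N y<N = begin
  length (filterᵇ closer (upTo (5 * n + 1))) ≡⟨ length-filterᵇ closer (upTo (5 * n + 1)) ⟩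
  sumUpTo (5 * n + 1) (bit ∘ closer)         ≡⟨ sumUpTo-vertices n (bit ∘ closer) ⟩
  sumUpTo n (λ j → sum (map (bit ∘ closer ∘ vertex j) block)) + bit (closer (vertex n 0F))
      ≡⟨ cong₂ _+_ (sum-map-cong {xs = upTo n} (λ {j} j∈ → blockViaSites j (∈-upTo⁻ j∈)))
                   (viaSites n 0F (m<m+n (5 * n) (s≤s z≤n))) ⟩
  sumUpTo n (λ j → sum (map (λ r → nearer (j , r) (i , a) (k , b)) block)) + nearer (n , 0F) (i , a) (k , b) ∎
  where
  open ≡-Reasoning
  closer : ℕ → Bool
  closer w = dist (paraChain n) w (vertex i a) <ᵇ dist (paraChain n) w (vertex k b)
  viaSites : ∀ j r → vertex j r < 5 * n + 1 → bit (closer (vertex j r)) ≡ nearer (j , r) (i , a) (k , b)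
  viaSites j r w<N = cong₂ (λ d d′ → bit (d <ᵇ d′)) (dist-vertex j r i a 1≤n w<N x<N) (dist-vertex j r k b 1≤n w<N y<N)
  blockViaSites : ∀ j → j < n → sum (map (bit ∘ closer ∘ vertex j) block) ≡ sum (map (λ r → nearer (j , r) (i , a) (k , b)) block)
  blockViaSites j j<n = sum-map-cong {xs = block} (λ {r} _ → viaSites j r (vertex< r j<n))

mClose-vertex : ∀ {n i a k b} → 1 ≤ n → vertex i a < 5 * n + 1 → vertex k b < 5 * n + 1 →
                mClose (paraChain n) (vertex i a) (vertex k b) ≡ sumUpTo n (λ j → sum (map (nearerEdge (i , a) (k , b) j) hexagon))
mClose-vertex {n} {i} {a} {k} {b} 1≤n x<N y<N = begin
  length (filterᵇ closer (concatMap hexEdges (upTo n)))   ≡⟨ length-filterᵇ closer (concatMap hexEdges (upTo n)) ⟩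
  sum (map (bit ∘ closer) (concatMap hexEdges (upTo n)))  ≡⟨ sum-map-concatMap (bit ∘ closer) hexEdges (upTo n) ⟩
  sumUpTo n (λ j → sum (map (bit ∘ closer) (hexEdges j))) ≡⟨ sum-map-cong {xs = upTo n} (λ {j} j∈ → hexagonViaSites j (∈-upTo⁻ j∈)) ⟩
  sumUpTo n (λ j → sum (map (nearerEdge (i , a) (k , b) j) hexagon)) ∎
  where
  open ≡-Reasoning
  closer : ℕ × ℕ → Bool
  closer f = distVE (paraChain n) (vertex i a) f <ᵇ distVE (paraChain n) (vertex k b) f
  viaSites : ∀ j c d → j < n → bit (closer (vertex j c , vertex j d)) ≡ nearerEdge (i , a) (k , b) j (c , d)
  viaSites j c d j<n = cong₂ (λ e e′ → bit (e <ᵇ e′))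
    (cong₂ _⊓_ (dist-vertex i a j c 1≤n x<N (vertex< c j<n)) (dist-vertex i a j d 1≤n x<N (vertex< d j<n)))
    (cong₂ _⊓_ (dist-vertex k b j c 1≤n y<N (vertex< c j<n)) (dist-vertex k b j d 1≤n y<N (vertex< d j<n)))
  hexagonViaSites : ∀ j → j < n → sum (map (bit ∘ closer) (hexEdges j)) ≡ sum (map (nearerEdge (i , a) (k , b) j) hexagon)
  hexagonViaSites j j<n = trans (cong sum (sym (map-∘ {g = bit ∘ closer} {f = inHexagon j} hexagon))) (sum-map-cong {xs = hexagon} (λ { {c , d} _ → viaSites j c d j<n }))

nearer-before : ∀ {j i} r a b → j < i → nearer (j , r) (i , a) (i , b) ≡ bit (hexDist 0F a <ᵇ hexDist 0F b)
nearer-before {j} {i} r a b j<i =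
  cong bit (trans (cong₂ _<ᵇ_ (siteDist-before r a j<i) (siteDist-before r b j<i)) (<ᵇ-cancelˡ (hexDist r 3F + span (i ∸ suc j)) (hexDist 0F a) (hexDist 0F b)))

nearer-after : ∀ {j i} r a b → i < j → nearer (j , r) (i , a) (i , b) ≡ bit (hexDist a 3F <ᵇ hexDist b 3F)
nearer-after {j} {i} r a b i<j =
  cong bit (trans (cong₂ _<ᵇ_ (siteDist-after r a i<j) (siteDist-after r b i<j)) (<ᵇ-cancelˡ (hexDist 0F r + span (j ∸ suc i)) (hexDist a 3F) (hexDist b 3F)))

nearer-same : ∀ i r a b → nearer (i , r) (i , a) (i , b) ≡ bit (hexDist r a <ᵇ hexDist r b)
nearer-same i r a b = cong bit (cong₂ _<ᵇ_ (siteDist-same i r a) (siteDist-same i r b))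

nearerEdge-before : ∀ {j i} a b c d → j < i → nearerEdge (i , a) (i , b) j (c , d) ≡ bit (hexDist 0F a <ᵇ hexDist 0F b)
nearerEdge-before {j} {i} a b c d j<i = cong bit (begin
  (distToEdge (i , a) j (c , d) <ᵇ distToEdge (i , b) j (c , d)) ≡⟨ cong₂ _<ᵇ_ (toEdge a) (toEdge b) ⟩
  ((hexDist 0F a + S) + m <ᵇ (hexDist 0F b + S) + m)             ≡⟨ <ᵇ-cancelʳ m (hexDist 0F a + S) (hexDist 0F b + S) ⟩
  (hexDist 0F a + S <ᵇ hexDist 0F b + S)                         ≡⟨ <ᵇ-cancelʳ S (hexDist 0F a) (hexDist 0F b) ⟩
  (hexDist 0F a <ᵇ hexDist 0F b)                                 ∎)
  where
  open ≡-Reasoning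
  S : ℕ
  S = span (i ∸ suc j)
  m : ℕ
  m = hexDist c 3F ⊓ hexDist d 3F
  toEdge : ∀ a → distToEdge (i , a) j (c , d) ≡ (hexDist 0F a + S) + m
  toEdge a = trans (cong₂ _⊓_ (siteDist-after a c j<i) (siteDist-after a d j<i)) (sym (+-distribˡ-⊓ (hexDist 0F a + S) (hexDist c 3F) (hexDist d 3F)))

nearerEdge-after : ∀ {j i} a b c d → i < j → nearerEdge (i , a) (i , b) j (c , d) ≡ bit (hexDist a 3F <ᵇ hexDist b 3F)
nearerEdge-after {j} {i} a b c d i<j = cong bit (begin
  (distToEdge (i , a) j (c , d) <ᵇ distToEdge (i , b) j (c , d)) ≡⟨ cong₂ _<ᵇ_ (toEdge a) (toEdge b) ⟩
  ((hexDist a 3F + S) + m <ᵇ (hexDist b 3F + S) + m)             ≡⟨ <ᵇ-cancelʳ m (hexDist a 3F + S) (hexDist b 3F + S) ⟩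
  (hexDist a 3F + S <ᵇ hexDist b 3F + S)                         ≡⟨ <ᵇ-cancelʳ S (hexDist a 3F) (hexDist b 3F) ⟩
  (hexDist a 3F <ᵇ hexDist b 3F)                                 ∎)
  where
  open ≡-Reasoning
  S : ℕ
  S = span (j ∸ suc i)
  m : ℕ
  m = hexDist 0F c ⊓ hexDist 0F d
  toEdge : ∀ a → distToEdge (i , a) j (c , d) ≡ (hexDist a 3F + S) + m
  toEdge a = trans (cong₂ _⊓_ (siteDist-before a c i<j) (siteDist-before a d i<j)) (sym (+-distribˡ-⊓ (hexDist a 3F + S) (hexDist 0F c) (hexDist 0F d)))

nearerEdge-same : ∀ i a b c d → nearerEdge (i , a) (i , b) i (c , d) ≡ bit (hexDistToEdge a (c , d) <ᵇ hexDistToEdge b (c , d))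
nearerEdge-same i a b c d =
  cong bit (cong₂ _<ᵇ_ (cong₂ _⊓_ (siteDist-same i a c) (siteDist-same i a d)) (cong₂ _⊓_ (siteDist-same i b c) (siteDist-same i b d)))

nClose-formula : ∀ {n i} a b → 1 ≤ n → i < n →
  nClose (paraChain n) (vertex i a) (vertex i b) ≡
  i * (5 * bit (hexDist 0F a <ᵇ hexDist 0F b)) + nearerInHexagon a b + (n ∸ suc i) * (5 * bit (hexDist a 3F <ᵇ hexDist b 3F))
    + bit (hexDist a 3F <ᵇ hexDist b 3F)
nClose-formula {n} {i} a b 1≤n i<n =
  trans (nClose-vertex {n} {i} {a} {i} {b} 1≤n (vertex< a i<n) (vertex< b i<n))
        (cong₂ _+_ (sumUpTo-regions i<n before at after) (nearer-after 0F a b i<n))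
  where
  before : ∀ {j} → j < i → sum (map (λ r → nearer (j , r) (i , a) (i , b)) block) ≡ 5 * bit (hexDist 0F a <ᵇ hexDist 0F b)
  before j<i = sum-map-const block (λ {r} _ → nearer-before r a b j<i)
  at : sum (map (λ r → nearer (i , r) (i , a) (i , b)) block) ≡ nearerInHexagon a b
  at = sum-map-cong {xs = block} (λ {r} _ → nearer-same i r a b)
  after : ∀ {j} → i < j → sum (map (λ r → nearer (j , r) (i , a) (i , b)) block) ≡ 5 * bit (hexDist a 3F <ᵇ hexDist b 3F)
  after i<j = sum-map-const block (λ {r} _ → nearer-after r a b i<j)

mClose-formula : ∀ {n i} a b → 1 ≤ n → i < n →
  mClose (paraChain n) (vertex i a) (vertex i b) ≡
  i * (6 * bit (hexDist 0F a <ᵇ hexDist 0F b)) + nearerEdgesInHexagon a b + (n ∸ suc i) * (6 * bit (hexDist a 3F <ᵇ hexDist b 3F))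
mClose-formula {n} {i} a b 1≤n i<n =
  trans (mClose-vertex {n} {i} {a} {i} {b} 1≤n (vertex< a i<n) (vertex< b i<n)) (sumUpTo-regions i<n before at after)
  where
  before : ∀ {j} → j < i → sum (map (nearerEdge (i , a) (i , b) j) hexagon) ≡ 6 * bit (hexDist 0F a <ᵇ hexDist 0F b)
  before j<i = sum-map-const hexagon (λ { {c , d} _ → nearerEdge-before a b c d j<i })
  at : sum (map (nearerEdge (i , a) (i , b) i) hexagon) ≡ nearerEdgesInHexagon a b
  at = sum-map-cong {xs = hexagon} (λ { {c , d} _ → nearerEdge-same i a b c d })
  after : ∀ {j} → i < j → sum (map (nearerEdge (i , a) (i , b) j) hexagon) ≡ 6 * bit (hexDist a 3F <ᵇ hexDist b 3F)
  after i<j = sum-map-const hexagon (λ { {c , d} _ → nearerEdge-after a b c d i<j })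

module _ {a b} (e : (a , b) ∈ hexagon) where

  toward-left : bit (hexDist 0F a <ᵇ hexDist 0F b) ≡ 1 × bit (hexDist 0F b <ᵇ hexDist 0F a) ≡ 0
  toward-left rewrite sym (proj₁ (hexagon-oriented e)) = bit-n<ᵇ1+n (hexDist 0F a) , bit-1+n<ᵇn (hexDist 0F a)

  toward-right : bit (hexDist a 3F <ᵇ hexDist b 3F) ≡ 0 × bit (hexDist b 3F <ᵇ hexDist a 3F) ≡ 1
  toward-right rewrite sym (proj₂ (hexagon-oriented e)) = bit-1+n<ᵇn (hexDist b 3F) , bit-n<ᵇ1+n (hexDist b 3F)

  nClose-hexagonEdge : ∀ {n i} → 1 ≤ n → i < n →
    nClose (paraChain n) (vertex i a) (vertex i b) ≡ 3 + 5 * i ×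
    nClose (paraChain n) (vertex i b) (vertex i a) ≡ 3 + 5 * (n ∸ suc i)
  nClose-hexagonEdge {n} {i} 1≤n i<n =
    trans (nClose-formula a b 1≤n i<n)
          (forward (proj₁ toward-left) (proj₁ (nearerInHexagon-edge e)) (proj₁ toward-right) i (n ∸ suc i)) ,
    trans (nClose-formula b a 1≤n i<n)
          (backward (proj₂ toward-left) (proj₂ (nearerInHexagon-edge e)) (proj₂ toward-right) i (n ∸ suc i))
    where
    forward : ∀ {L M R} → L ≡ 1 → M ≡ 3 → R ≡ 0 → ∀ i d → i * (5 * L) + M + d * (5 * R) + R ≡ 3 + 5 * i
    forward refl refl refl = solve-∀
    backward : ∀ {L M R} → L ≡ 0 → M ≡ 2 → R ≡ 1 → ∀ i d → i * (5 * L) + M + d * (5 * R) + R ≡ 3 + 5 * d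
    backward refl refl refl = solve-∀

  mClose-hexagonEdge : ∀ {n i} → 1 ≤ n → i < n →
    mClose (paraChain n) (vertex i a) (vertex i b) ≡ 2 + 6 * i ×
    mClose (paraChain n) (vertex i b) (vertex i a) ≡ 2 + 6 * (n ∸ suc i)
  mClose-hexagonEdge {n} {i} 1≤n i<n =
    trans (mClose-formula a b 1≤n i<n)
          (forward (proj₁ toward-left) (proj₁ (nearerEdgesInHexagon-edge e)) (proj₁ toward-right) i (n ∸ suc i)) ,
    trans (mClose-formula b a 1≤n i<n)
          (backward (proj₂ toward-left) (proj₂ (nearerEdgesInHexagon-edge e)) (proj₂ toward-right) i (n ∸ suc i))
    where
    forward : ∀ {L M R} → L ≡ 1 → M ≡ 2 → R ≡ 0 → ∀ i d → i * (6 * L) + M + d * (6 * R) ≡ 2 + 6 * i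
    forward refl refl refl = solve-∀
    backward : ∀ {L M R} → L ≡ 0 → M ≡ 2 → R ≡ 1 → ∀ i d → i * (6 * L) + M + d * (6 * R) ≡ 2 + 6 * d
    backward refl refl refl = solve-∀

balance : ℕ → ℕ
balance n = sumUpTo n (λ i → ∣ i - (n ∸ suc i) ∣)

imbalanceSum : ∀ {n} (c : ℕ → ℕ → ℕ) k₀ k →
  (∀ {i a b} → i < n → (a , b) ∈ hexagon →
     c (vertex i a) (vertex i b) ≡ k₀ + k * i × c (vertex i b) (vertex i a) ≡ k₀ + k * (n ∸ suc i)) →
  sum (map (λ e → ∣ c (proj₁ e) (proj₂ e) - c (proj₂ e) (proj₁ e) ∣) (edges (paraChain n))) ≡ 6 * k * balance n
imbalanceSum {n} c k₀ k counts = begin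
  sum (map imbalance (concatMap hexEdges (upTo n)))  ≡⟨ sum-map-concatMap imbalance hexEdges (upTo n) ⟩
  sumUpTo n (λ i → sum (map imbalance (hexEdges i))) ≡⟨ sum-map-cong {xs = upTo n} (λ {i} i∈ → perHexagon i (∈-upTo⁻ i∈)) ⟩
  sumUpTo n (λ i → 6 * k * ∣ i - (n ∸ suc i) ∣)      ≡⟨ sum-map-*ˡ (6 * k) _ (upTo n) ⟩
  6 * k * balance n                                  ∎
  where
  open ≡-Reasoning
  imbalance : ℕ × ℕ → ℕ
  imbalance e = ∣ c (proj₁ e) (proj₂ e) - c (proj₂ e) (proj₁ e) ∣
  perEdge : ∀ {i a b} → i < n → (a , b) ∈ hexagon → imbalance (vertex i a , vertex i b) ≡ k * ∣ i - (n ∸ suc i) ∣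
  perEdge {i} i<n e = begin
    ∣ c _ _ - c _ _ ∣                     ≡⟨ cong₂ ∣_-_∣ (proj₁ (counts i<n e)) (proj₂ (counts i<n e)) ⟩
    ∣ k₀ + k * i - k₀ + k * (n ∸ suc i) ∣ ≡⟨ ∣m+n-m+o∣≡∣n-o∣ k₀ (k * i) _ ⟩
    ∣ k * i - k * (n ∸ suc i) ∣           ≡⟨ *-distribˡ-∣-∣ k i _ ⟨
    k * ∣ i - (n ∸ suc i) ∣               ∎
  perHexagon : ∀ i → i < n → sum (map imbalance (hexEdges i)) ≡ 6 * k * ∣ i - (n ∸ suc i) ∣
  perHexagon i i<n = begin
    sum (map imbalance (map (inHexagon i) hexagon)) ≡⟨ cong sum (map-∘ {g = imbalance} {f = inHexagon i} hexagon) ⟨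
    sum (map (imbalance ∘ inHexagon i) hexagon)     ≡⟨ sum-map-const hexagon (λ { {a , b} e → perEdge i<n e }) ⟩
    6 * (k * ∣ i - (n ∸ suc i) ∣)                   ≡⟨ *-assoc 6 k _ ⟨
    6 * k * ∣ i - (n ∸ suc i) ∣                     ∎

balance-suc-suc : ∀ n → balance (suc (suc n)) ≡ balance n + 2 * suc n
balance-suc-suc n = begin
  sumUpTo (suc (suc n)) f             ≡⟨ sumUpTo-suc (suc n) f ⟩
  sumUpTo (suc n) f + f (suc n)       ≡⟨ cong₂ _+_ (sumUpTo-sucˡ n f) (cong (λ m → ∣ suc n - m ∣) (n∸n≡0 n)) ⟩
  suc n + sumUpTo n (f ∘ suc) + suc n ≡⟨ cong (λ s → suc n + s + suc n) inner ⟩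
  suc n + balance n + suc n           ≡⟨ rearrange (suc n) (balance n) ⟩
  balance n + 2 * suc n               ∎
  where
  open ≡-Reasoning
  f : ℕ → ℕ
  f i = ∣ i - (suc n ∸ i) ∣
  inner : sumUpTo n (f ∘ suc) ≡ balance n
  inner = sum-map-cong {xs = upTo n} (λ {i} i∈ → cong (λ m → ∣ suc i - m ∣) (∸-suc (∈-upTo⁻ i∈)))
  rearrange : ∀ m b → m + b + m ≡ b + 2 * m
  rearrange = solve-∀

balance-even : ∀ k → balance (2 * k) ≡ 2 * k * k
balance-even zero    = refl
balance-even (suc k) = begin
  balance (2 * suc k)               ≡⟨ cong balance (*-suc 2 k) ⟩
  balance (suc (suc (2 * k)))       ≡⟨ balance-suc-suc (2 * k) ⟩
  balance (2 * k) + 2 * suc (2 * k) ≡⟨ cong (_+ 2 * suc (2 * k)) (balance-even k) ⟩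
  2 * k * k + 2 * suc (2 * k)       ≡⟨ arithmetic k ⟩
  2 * suc k * suc k                 ∎
  where
  open ≡-Reasoning
  arithmetic : ∀ k → 2 * k * k + 2 * suc (2 * k) ≡ 2 * suc k * suc k
  arithmetic = solve-∀

balance-odd : ∀ k → balance (2 * k + 1) ≡ 2 * k * k + 2 * k
balance-odd zero    = refl
balance-odd (suc k) = begin
  balance (2 * suc k + 1)                   ≡⟨ cong (λ m → balance (m + 1)) (*-suc 2 k) ⟩
  balance (suc (suc (2 * k + 1)))           ≡⟨ balance-suc-suc (2 * k + 1) ⟩
  balance (2 * k + 1) + 2 * suc (2 * k + 1) ≡⟨ cong (_+ 2 * suc (2 * k + 1)) (balance-odd k) ⟩
  2 * k * k + 2 * k + 2 * suc (2 * k + 1)   ≡⟨ arithmetic k ⟩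
  2 * suc k * suc k + 2 * suc k             ∎
  where
  open ≡-Reasoning
  arithmetic : ∀ k → 2 * k * k + 2 * k + 2 * suc (2 * k + 1) ≡ 2 * suc k * suc k + 2 * suc k
  arithmetic = solve-∀

Mo-paraChain : ∀ {n} → 1 ≤ n → Mo (paraChain n) ≡ 30 * balance n
Mo-paraChain {n} 1≤n = imbalanceSum (nClose (paraChain n)) 3 5 (λ i<n e → nClose-hexagonEdge e 1≤n i<n)

Moe-paraChain : ∀ {n} → 1 ≤ n → Moe (paraChain n) ≡ 36 * balance n
Moe-paraChain {n} 1≤n = imbalanceSum (mClose (paraChain n)) 2 6 (λ i<n e → mClose-hexagonEdge e 1≤n i<n)

*-even : ∀ c k → c * (2 * k * k) ≡ 2 * c * k * k
*-even = solve-∀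

*-odd : ∀ c k → c * (2 * k * k + 2 * k) ≡ 2 * c * k * k + 2 * c * k
*-odd = solve-∀

mainTheorem14 : ∀ (n k : ℕ) → n ≥ 1 → k ≥ 1 →
    ((n ≡ 2 * k → Mo (paraChain n) ≡ 60 * k * k)
    × (n ≡ 2 * k + 1 → Mo (paraChain n) ≡ 60 * k * k + 60 * k))
    × ((n ≡ 2 * k → Moe (paraChain n) ≡ 72 * k * k)
    × (n ≡ 2 * k + 1 → Moe (paraChain n) ≡ 72 * k * k + 72 * k))
mainTheorem14 n k n≥1 _ =
  ( (λ { refl → trans (Mo-paraChain n≥1) (trans (cong (30 *_) (balance-even k)) (*-even 30 k)) })
  , (λ { refl → trans (Mo-paraChain n≥1) (trans (cong (30 *_) (balance-odd k)) (*-odd 30 k)) }) )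
  , ( (λ { refl → trans (Moe-paraChain n≥1) (trans (cong (36 *_) (balance-even k)) (*-even 36 k)) })
    , (λ { refl → trans (Moe-paraChain n≥1) (trans (cong (36 *_) (balance-odd k)) (*-odd 36 k)) }) )
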